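{- Let $\mathcal{F}=\mathcal{F}_{11}\cup\mathcal{F}_{12}\cup\mathcal{F}_{21}\cup\mathcal{F}_{22}\cup\mathcal{F}_3\cup\mathcal{F}_4$, where (all parameters being integers) $\mathcal{F}_{11}=\{G^*(1,1,1,1,1,n,n,0,0,0,0): n\ge1\}$; $\mathcal{F}_{12}=\{G^*(1,1,1,0,1,n+1,n+1,1,0,0,0): n\ge1\}$; $\mathcal{F}_{21}=\{G^*(1,1,1,n-r-s+1,1,r,n,s,0,0,0): n-1\ge r\ge1,\ n-1\ge s\ge1,\ n\ge r+s\}$; $\mathcal{F}_{22}=\{G^*(1,1,1,n-r-s,1,r+1,n+1,s+1,0,0,0): n-1\ge r\ge1,\ n-1\ge s\ge1,\ n\ge r+s\}$; $\mathcal{F}_{3}=\{G^*(1,1,r+1,s+1,1,0,n-s,n-r,0,0,0): n-1\ge r\ge1,\ n-1\ge s\ge1\}$; $\mathcal{F}_{4}=\{G^*(r+1,n+1,s+1,1,1,0,0,0,0,0,n-r-s): n-1\ge r\ge1,\ n-1\ge s\ge1,\ n\ge r+s\}$. If $G\in\mathcal{F}$ is well-edge-dominated, then $G$ is isomorphic to $H^*$.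
   Context: All graphs are finite and simple. $G^*$ is the graph with vertices $u_1,\dots,u_{11}$ and edges $u_{10}u_{11}, u_{11}u_2, u_2u_3, u_3u_8, u_8u_7, u_7u_6, u_6u_5, u_5u_9, u_9u_{10}, u_1u_{10}, u_1u_2, u_1u_5, u_4u_3, u_4u_7, u_4u_5$. For a graph $H$ with vertices $v_1,\dots,v_k$ and nonnegative integers $m_1,\dots,m_k$, $H(m_1,\dots,m_k)$ is the graph obtained from $H$ by replacing each vertex $v_i$ with an independent set of $m_i$ vertices, each having the same neighborhood as $v_i$ (i.e. each new vertex is adjacent exactly to all vertices replacing neighbors of $v_i$; if $m_i=0$, $v_i$ is deleted); here the vertices of $G^*$ are taken in the order $u_1,\dots,u_{11}$. $H^*$ is the graph with vertex set $\{v_1,\dots,v_7\}$ and edges $v_1v_2, v_2v_3, v_3v_4, v_4v_5, v_5v_1, v_4v_6, v_6v_7, v_7v_5$. A set $F$ of edges is an edge dominating set if every edge not in $F$ shares an endpoint with some edge of $F$; it is minimal if no proper subset is. A graph is well-edge-dominated if all its minimal edge dominating sets have the same cardinality. -}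

module Defs where

open import Data.Bool using (Bool; true; false; _∧_; _∨_; if_then_else_)
open import Data.Bool.Properties using (∧-comm; ∨-comm)
open import Data.Nat using (ℕ; zero; suc; _+_; _<ᵇ_)
open import Data.Fin using (Fin; zero; suc; toℕ; splitAt; #_)
open import Data.Fin.Subset using (Subset; _∈_; _∉_; _⊂_; ∣_∣)
open import Data.Fin.Properties using (_≟_)
open import Data.List using (List; []; _∷_; concatMap; length; lookup; allFin)
open import Data.Vec using (Vec; []; _∷_; sum)
open import Data.Product using (Σ; _×_; _,_; proj₁; proj₂; ∃-syntax)
open import Data.Sum using (_⊎_; inj₁; inj₂)
open import Function.Bundles using (Bijection; _⤖_)
open import Relation.Nullary using (¬_; does)
open import Relation.Binary.PropositionalEquality using (_≡_; refl; cong; cong₂; trans)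

record Graph : Set where
  field
    n      : ℕ
    adj    : Fin n → Fin n → Bool
    sym    : ∀ i j → adj i j ≡ adj j i
    irrefl : ∀ i → adj i i ≡ false
open Graph public

_≅_ : Graph → Graph → Set
G ≅ H = Σ (Fin (n G) ⤖ Fin (n H)) λ f →
          (∀ i j → adj H (Bijection.to f i) (Bijection.to f j) ≡ adj G i j)

eqb : ∀ {k} → Fin k → Fin k → Bool
eqb a b = does (a ≟ b)

adjL : ∀ {k} → List (Fin k × Fin k) → Fin k → Fin k → Bool
adjL [] i j = false
adjL ((a , b) ∷ E) i j = ((eqb i a ∧ eqb j b) ∨ (eqb i b ∧ eqb j a)) ∨ adjL E i j

adjL-sym : ∀ {k} (E : List (Fin k × Fin k)) i j → adjL E i j ≡ adjL E j i
adjL-sym [] i j = refl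
adjL-sym ((a , b) ∷ E) i j =
  cong₂ _∨_
    (trans (∨-comm (eqb i a ∧ eqb j b) (eqb i b ∧ eqb j a))
           (cong₂ _∨_ (∧-comm (eqb i b) (eqb j a)) (∧-comm (eqb i a) (eqb j b))))
    (adjL-sym E i j)

u1 u2 u3 u4 u5 u6 u7 u8 u9 u10 u11 : Fin 11
u1 = zero
u2 = # 1
u3 = # 2
u4 = # 3
u5 = # 4
u6 = # 5
u7 = # 6
u8 = # 7
u9 = # 8
u10 = # 9
u11 = # 10

G*-edges : List (Fin 11 × Fin 11)
G*-edges = (u10 , u11) ∷ (u11 , u2) ∷ (u2 , u3) ∷ (u3 , u8) ∷ (u8 , u7) ∷ (u7 , u6)
         ∷ (u6 , u5) ∷ (u5 , u9) ∷ (u9 , u10) ∷ (u1 , u10) ∷ (u1 , u2) ∷ (u1 , u5)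
         ∷ (u4 , u3) ∷ (u4 , u7) ∷ (u4 , u5) ∷ []

G*-irrefl : ∀ i → adjL G*-edges i i ≡ false
G*-irrefl zero = refl
G*-irrefl (suc zero) = refl
G*-irrefl (suc (suc zero)) = refl
G*-irrefl (suc (suc (suc zero))) = refl
G*-irrefl (suc (suc (suc (suc zero)))) = refl
G*-irrefl (suc (suc (suc (suc (suc zero))))) = refl
G*-irrefl (suc (suc (suc (suc (suc (suc zero)))))) = refl
G*-irrefl (suc (suc (suc (suc (suc (suc (suc zero))))))) = refl
G*-irrefl (suc (suc (suc (suc (suc (suc (suc (suc zero)))))))) = refl
G*-irrefl (suc (suc (suc (suc (suc (suc (suc (suc (suc zero))))))))) = refl
G*-irrefl (suc (suc (suc (suc (suc (suc (suc (suc (suc (suc zero)))))))))) = refl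

G* : Graph
G* = record { n = 11 ; adj = adjL G*-edges ; sym = adjL-sym G*-edges ; irrefl = G*-irrefl }

v1 v2 v3 v4 v5 v6 v7 : Fin 7
v1 = zero
v2 = # 1
v3 = # 2
v4 = # 3
v5 = # 4
v6 = # 5
v7 = # 6

H*-edges : List (Fin 7 × Fin 7)
H*-edges = (v1 , v2) ∷ (v2 , v3) ∷ (v3 , v4) ∷ (v4 , v5) ∷ (v5 , v1) ∷ (v4 , v6)
         ∷ (v6 , v7) ∷ (v7 , v5) ∷ []

H*-irrefl : ∀ i → adjL H*-edges i i ≡ false
H*-irrefl zero = refl
H*-irrefl (suc zero) = refl
H*-irrefl (suc (suc zero)) = refl
H*-irrefl (suc (suc (suc zero))) = refl
H*-irrefl (suc (suc (suc (suc zero)))) = refl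
H*-irrefl (suc (suc (suc (suc (suc zero))))) = refl
H*-irrefl (suc (suc (suc (suc (suc (suc zero)))))) = refl

H* : Graph
H* = record { n = 7 ; adj = adjL H*-edges ; sym = adjL-sym H*-edges ; irrefl = H*-irrefl }

-- Blow-up H(m_1,...,m_k): vertex v_i is replaced by an independent set of
-- m_i vertices (blocks laid out consecutively in Fin (m_1 + ... + m_k));
-- two new vertices are adjacent iff the original vertices they replace are.

label : ∀ {k} (ms : Vec ℕ k) → Fin (sum ms) → Fin k
label (m ∷ ms) x with splitAt m x
... | inj₁ _ = zero
... | inj₂ y = suc (label ms y)

blowup : (H : Graph) → Vec ℕ (n H) → Graph
blowup H ms = record
  { n = sum ms
  ; adj = λ x y → adj H (label ms x) (label ms y)
  ; sym = λ x y → sym H (label ms x) (label ms y)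
  ; irrefl = λ x → irrefl H (label ms x)
  }

edgeList : (G : Graph) → List (Fin (n G) × Fin (n G))
edgeList G = concatMap (λ i → concatMap (λ j →
               if (toℕ i <ᵇ toℕ j) ∧ adj G i j then (i , j) ∷ [] else [])
               (allFin (n G))) (allFin (n G))

nE : Graph → ℕ
nE G = length (edgeList G)

ends : (G : Graph) → Fin (nE G) → Fin (n G) × Fin (n G)
ends G e = lookup (edgeList G) e

ShareEnd : (G : Graph) → Fin (nE G) → Fin (nE G) → Set
ShareEnd G e f =
  let a = proj₁ (ends G e) ; b = proj₂ (ends G e)
      c = proj₁ (ends G f) ; d = proj₂ (ends G f)
  in (a ≡ c) ⊎ (a ≡ d) ⊎ (b ≡ c) ⊎ (b ≡ d)

IsEDS : (G : Graph) → Subset (nE G) → Set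
IsEDS G F = ∀ e → e ∉ F → ∃[ f ] (f ∈ F × ShareEnd G e f)

IsMinimalEDS : (G : Graph) → Subset (nE G) → Set
IsMinimalEDS G F = IsEDS G F × (∀ F′ → F′ ⊂ F → ¬ IsEDS G F′)

WellEdgeDominated : Graph → Set
WellEdgeDominated G =
  ∀ F F′ → IsMinimalEDS G F → IsMinimalEDS G F′ → ∣ F ∣ ≡ ∣ F′ ∣

open import Data.Nat using (_≤_; _∸_)

InF11 InF12 InF21 InF22 InF3 InF4 InFamily : Vec ℕ 11 → Set
InF11 ms = ∃[ k ] (1 ≤ k × ms ≡ (1 ∷ 1 ∷ 1 ∷ 1 ∷ 1 ∷ k ∷ k ∷ 0 ∷ 0 ∷ 0 ∷ 0 ∷ []))
InF12 ms = ∃[ k ] (1 ≤ k × ms ≡ (1 ∷ 1 ∷ 1 ∷ 0 ∷ 1 ∷ suc k ∷ suc k ∷ 1 ∷ 0 ∷ 0 ∷ 0 ∷ []))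
InF21 ms = ∃[ k ] ∃[ r ] ∃[ s ] (1 ≤ r × r + 1 ≤ k × 1 ≤ s × s + 1 ≤ k × r + s ≤ k ×
             ms ≡ (1 ∷ 1 ∷ 1 ∷ (k ∸ r ∸ s) + 1 ∷ 1 ∷ r ∷ k ∷ s ∷ 0 ∷ 0 ∷ 0 ∷ []))
InF22 ms = ∃[ k ] ∃[ r ] ∃[ s ] (1 ≤ r × r + 1 ≤ k × 1 ≤ s × s + 1 ≤ k × r + s ≤ k ×
             ms ≡ (1 ∷ 1 ∷ 1 ∷ k ∸ r ∸ s ∷ 1 ∷ r + 1 ∷ k + 1 ∷ s + 1 ∷ 0 ∷ 0 ∷ 0 ∷ []))
InF3 ms = ∃[ k ] ∃[ r ] ∃[ s ] (1 ≤ r × r + 1 ≤ k × 1 ≤ s × s + 1 ≤ k ×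
             ms ≡ (1 ∷ 1 ∷ r + 1 ∷ s + 1 ∷ 1 ∷ 0 ∷ k ∸ s ∷ k ∸ r ∷ 0 ∷ 0 ∷ 0 ∷ []))
InF4 ms = ∃[ k ] ∃[ r ] ∃[ s ] (1 ≤ r × r + 1 ≤ k × 1 ≤ s × s + 1 ≤ k × r + s ≤ k ×
             ms ≡ (r + 1 ∷ k + 1 ∷ s + 1 ∷ 1 ∷ 1 ∷ 0 ∷ 0 ∷ 0 ∷ 0 ∷ 0 ∷ k ∸ r ∸ s ∷ []))
InFamily ms = InF11 ms ⊎ InF12 ms ⊎ InF21 ms ⊎ InF22 ms ⊎ InF3 ms ⊎ InF4 ms

-- Apart from G*(1,1,1,1,1,1,1,0,0,0,0), which is H* after swapping u₆ and u₇, every graph of the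
-- family has two minimal edge dominating sets whose sizes differ by one. Both are described
-- uniformly in the parameters: the vertices of a blow-up fall into classes (the first copy of u_a,
-- and the other copies of u_a), and an edge set is given by a list of pairs of classes, namely all
-- edges between the paired classes. Whether such a set is a minimal edge dominating set depends
-- only on which classes are certainly nonempty and which possibly are, so it is decided by a
-- finite computation on the 22 classes. The two sets add two, resp. one, pairs of single vertices
-- to a common list, so their sizes are c + 2 and c + 1.
module Submission where

open import Data.Bool using (Bool; true; false; T; _∧_; _∨_; if_then_else_)
open import Data.Bool.Properties using (T-∧; T-∨; T-≡; ∨-comm)
import Data.Bool.Properties as Bool
open import Data.Empty using (⊥-elim)
open import Data.Fin using (Fin; zero; suc; toℕ; splitAt; _↑ˡ_; _↑ʳ_)
open import Data.Fin.Permutation using (Permutation′; transpose; _⟨$⟩ʳ_)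
open import Data.Fin.Properties using (<-cmp; all?; any?; splitAt-↑ˡ; splitAt-↑ʳ; splitAt⁻¹-↑ˡ; splitAt⁻¹-↑ʳ)
import Data.Fin.Properties as Fin
open import Data.Fin.Subset using (Subset; _∈_; _∉_; _⊆_; _⊂_; _∪_; ⁅_⁆; ∣_∣; outside; inside)
open import Data.Fin.Subset.Properties
  using (_∈?_; ∪-identityʳ; ⊆-antisym; x∈p∪q⁺; x∈p∪q⁻; x∈⁅x⁆; x∈⁅y⁆⇒x≡y)
open import Data.List using (List; []; _∷_; _++_; map; concatMap; filter; cartesianProduct; allFin; lookup)
open import Data.List.Properties using (filter-++)
open import Data.List.Membership.Propositional using () renaming (_∈_ to _∈ₗ_)
open import Data.List.Membership.Propositional.Properties
  using (∈-filter⁺; ∈-filter⁻; ∈-cartesianProduct⁺; ∈-lookup; ∈-allFin)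
import Data.List.Relation.Unary.All as All
open import Data.List.Relation.Unary.Any using (index)
open import Data.List.Relation.Unary.Any.Properties using (lookup-index)
open import Data.List.Relation.Unary.AllPairs using (_∷_)
open import Data.List.Relation.Unary.Unique.Propositional using (Unique)
open import Data.List.Relation.Unary.Unique.Propositional.Properties
  using (filter⁺; cartesianProduct⁺; allFin⁺)
open import Data.Nat using (ℕ; zero; suc; _+_; _∸_; _<_; _≤_; _≤?_; s≤s; z≤n; _<ᵇ_; _⊓_)
open import Data.Nat.Properties
  using (1+n≢n; +-comm; +-monoˡ-≤; m≤n+m; m+n≤o⇒m≤o∸n; m⊓n≤n; <ᵇ⇒<; <⇒<ᵇ; <-asym; ≤-refl; ≤-trans; ⊓-glb)
open import Data.Product using (∃; ∃-syntax; _×_; _,_; proj₁; proj₂)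
open import Data.Product.Properties using (≡-dec)
open import Data.Sum using (_⊎_; inj₁; inj₂; [_,_]′)
open import Data.Vec using (Vec; []; _∷_; sum; tabulate; here; there) renaming (lookup to lookupᵥ)
open import Data.Vec.Properties using (lookup∘tabulate; []=⇒lookup; lookup⇒[]=)
open import Data.Vec.Relation.Binary.Pointwise.Inductive as Pointwise using (Pointwise; []; _∷_)
open import Function using (_∘_)
open import Function.Bundles using (Equivalence)
open import Function.Properties.Inverse using (↔⇒⤖)
open import Relation.Binary.Definitions using (DecidableEquality; tri<; tri≈; tri>)
open import Relation.Binary.PropositionalEquality
  using (_≡_; refl; sym; trans; cong; cong₂; subst; module ≡-Reasoning)
open import Relation.Nullary using (¬_; Dec; yes; no)
open import Relation.Nullary.Decidable
  using (True; T?; ⌊_⌋; map′; ¬?; _×-dec_; _⊎-dec_; _→-dec_; toWitness; fromWitness)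
open import Relation.Unary using (Decidable)

open import Defs hiding (sym)

private variable
  k : ℕ

lookup-injective : ∀ {A : Set} {xs : List A} → Unique xs → ∀ i j → lookup xs i ≡ lookup xs j → i ≡ j
lookup-injective {xs = _ ∷ _} _ zero zero _ = refl
lookup-injective {xs = _ ∷ _} (x∉xs ∷ _) zero (suc j) eq = ⊥-elim (All.lookup x∉xs (∈-lookup j) eq)
lookup-injective {xs = _ ∷ _} (x∉xs ∷ _) (suc i) zero eq = ⊥-elim (All.lookup x∉xs (∈-lookup i) (sym eq))
lookup-injective {xs = _ ∷ _} (_ ∷ u) (suc i) (suc j) eq = cong suc (lookup-injective u i j eq)

module _ (G : Graph) where

  Vertex Edge : Set
  Vertex = Fin (n G)
  Edge = Fin (nE G)

  isEdge : Vertex × Vertex → Bool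
  isEdge (i , j) = (toℕ i <ᵇ toℕ j) ∧ adj G i j

  private
    candidates : List (Vertex × Vertex)
    candidates = cartesianProduct (allFin (n G)) (allFin (n G))

    row≡filter : ∀ i (js : List Vertex) →
      concatMap (λ j → if isEdge (i , j) then (i , j) ∷ [] else []) js ≡ filter (T? ∘ isEdge) (map (i ,_) js)
    row≡filter i [] = refl
    row≡filter i (j ∷ js) with isEdge (i , j)
    ... | true  = cong ((i , j) ∷_) (row≡filter i js)
    ... | false = row≡filter i js

    rows≡filter : ∀ (is : List Vertex) →
      concatMap (λ i → concatMap (λ j → if isEdge (i , j) then (i , j) ∷ [] else []) (allFin (n G))) is
        ≡ filter (T? ∘ isEdge) (cartesianProduct is (allFin (n G)))
    rows≡filter [] = refl
    rows≡filter (i ∷ is) = begin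
      _ ≡⟨ cong₂ _++_ (row≡filter i (allFin (n G))) (rows≡filter is) ⟩
      filter (T? ∘ isEdge) (map (i ,_) (allFin (n G)))
        ++ filter (T? ∘ isEdge) (cartesianProduct is (allFin (n G)))
        ≡⟨ filter-++ (T? ∘ isEdge) (map (i ,_) (allFin (n G))) _ ⟨
      _ ∎
      where open ≡-Reasoning

  edgeList≡filter : edgeList G ≡ filter (T? ∘ isEdge) candidates
  edgeList≡filter = rows≡filter (allFin (n G))

  ends-injective : ∀ {e f} → ends G e ≡ ends G f → e ≡ f
  ends-injective = lookup-injective unique _ _
    where
    unique : Unique (edgeList G)
    unique = subst Unique (sym edgeList≡filter)
                   (filter⁺ (T? ∘ isEdge) (cartesianProduct⁺ (allFin⁺ _) (allFin⁺ _)))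

  ends-isEdge : ∀ e → T (isEdge (ends G e))
  ends-isEdge e = proj₂ (∈-filter⁻ (T? ∘ isEdge) {xs = candidates}
                           (subst (ends G e ∈ₗ_) edgeList≡filter (∈-lookup e)))

  ends-ordered : ∀ {e x y} → ends G e ≡ (x , y) → toℕ x < toℕ y
  ends-ordered {e} refl = <ᵇ⇒< _ _ (proj₁ (Equivalence.to T-∧ (ends-isEdge e)))

  ends-adjacent : ∀ {e x y} → ends G e ≡ (x , y) → T (adj G x y)
  ends-adjacent {e} refl = proj₂ (Equivalence.to T-∧ (ends-isEdge e))

  ends-surjective : ∀ {x y} → toℕ x < toℕ y → T (adj G x y) → ∃[ e ] ends G e ≡ (x , y)
  ends-surjective {x} {y} x<y xy = index xy∈ , sym (lookup-index xy∈)
    where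
    xy∈ : (x , y) ∈ₗ edgeList G
    xy∈ = subst ((x , y) ∈ₗ_) (sym edgeList≡filter)
            (∈-filter⁺ (T? ∘ isEdge) (∈-cartesianProduct⁺ (∈-allFin x) (∈-allFin y))
                       (Equivalence.from T-∧ (<⇒<ᵇ x<y , xy)))

  Joins : Edge → Vertex → Vertex → Set
  Joins e x y = ends G e ≡ (x , y) ⊎ ends G e ≡ (y , x)

  joins-sym : ∀ {e x y} → Joins e x y → Joins e y x
  joins-sym (inj₁ eq) = inj₂ eq
  joins-sym (inj₂ eq) = inj₁ eq

  edge-joining : ∀ {x y} → T (adj G x y) → ∃[ e ] Joins e x y
  edge-joining {x} {y} xy with <-cmp x y
  ... | tri< x<y _ _ = let e , eq = ends-surjective x<y xy in e , inj₁ eq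
  ... | tri≈ _ refl _ = ⊥-elim (subst T (Graph.irrefl G x) xy)
  ... | tri> _ _ y<x = let e , eq = ends-surjective y<x (subst T (Graph.sym G x y) xy) in e , inj₂ eq

  joins-unique : ∀ {e f x y} → Joins e x y → Joins f x y → e ≡ f
  joins-unique (inj₁ p) (inj₁ q) = ends-injective (trans p (sym q))
  joins-unique (inj₂ p) (inj₂ q) = ends-injective (trans p (sym q))
  joins-unique (inj₁ p) (inj₂ q) = ⊥-elim (<-asym (ends-ordered p) (ends-ordered q))
  joins-unique (inj₂ p) (inj₁ q) = ⊥-elim (<-asym (ends-ordered p) (ends-ordered q))

  Incident : Edge → Vertex → Set
  Incident e v = proj₁ (ends G e) ≡ v ⊎ proj₂ (ends G e) ≡ v

  joins⇒incident : ∀ {e x y} → Joins e x y → Incident e x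
  joins⇒incident (inj₁ refl) = inj₁ refl
  joins⇒incident (inj₂ refl) = inj₂ refl

  incident⇒joins : ∀ {e v} → Incident e v → ∃[ w ] Joins e v w
  incident⇒joins (inj₁ refl) = _ , inj₁ refl
  incident⇒joins (inj₂ refl) = _ , inj₂ refl

  incident-joins : ∀ {e x y v} → Joins e x y → Incident e v → v ≡ x ⊎ v ≡ y
  incident-joins (inj₁ refl) (inj₁ refl) = inj₁ refl
  incident-joins (inj₁ refl) (inj₂ refl) = inj₂ refl
  incident-joins (inj₂ refl) (inj₁ refl) = inj₂ refl
  incident-joins (inj₂ refl) (inj₂ refl) = inj₁ refl

  shareEnd⇒incident : ∀ {e f} → ShareEnd G e f → ∃[ v ] (Incident e v × Incident f v)
  shareEnd⇒incident (inj₁ p)               = _ , inj₁ refl , inj₁ (sym p)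
  shareEnd⇒incident (inj₂ (inj₁ p))        = _ , inj₁ refl , inj₂ (sym p)
  shareEnd⇒incident (inj₂ (inj₂ (inj₁ p))) = _ , inj₂ refl , inj₁ (sym p)
  shareEnd⇒incident (inj₂ (inj₂ (inj₂ p))) = _ , inj₂ refl , inj₂ (sym p)

  incident⇒shareEnd : ∀ {e f v} → Incident e v → Incident f v → ShareEnd G e f
  incident⇒shareEnd (inj₁ p) (inj₁ q) = inj₁ (trans p (sym q))
  incident⇒shareEnd (inj₁ p) (inj₂ q) = inj₂ (inj₁ (trans p (sym q)))
  incident⇒shareEnd (inj₂ p) (inj₁ q) = inj₂ (inj₂ (inj₁ (trans p (sym q))))
  incident⇒shareEnd (inj₂ p) (inj₂ q) = inj₂ (inj₂ (inj₂ (trans p (sym q))))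

  -- Every edge shares an end with itself, so a private edge of f is either f or outside F.
  PrivateEdge : Subset (nE G) → Edge → Edge → Set
  PrivateEdge F f e = ∀ g → g ∈ F → ShareEnd G e g → g ≡ f

  privateEdge-byEnds : ∀ {F f e x y} → Joins e x y →
                       (∀ {g w} → g ∈ F → Joins g x w → g ≡ f) →
                       (∀ {g w} → g ∈ F → Joins g y w → g ≡ f) →
                       PrivateEdge F f e
  privateEdge-byEnds e-xy at-x at-y g g∈F e~g with shareEnd⇒incident e~g
  ... | v , e∋v , g∋v with incident⇒joins g∋v | incident-joins e-xy e∋v
  ...   | _ , g-vw | inj₁ refl = at-x g∈F g-vw
  ...   | _ , g-vw | inj₂ refl = at-y g∈F g-vw

  isEDS∧private⇒isMinimalEDS : ∀ {F} → IsEDS G F → (∀ f → f ∈ F → ∃[ e ] PrivateEdge F f e) →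
                               IsMinimalEDS G F
  isEDS∧private⇒isMinimalEDS {F} eds privateEdge = eds , not-eds
    where
    not-eds : ∀ F′ → F′ ⊂ F → ¬ IsEDS G F′
    not-eds F′ (F′⊆F , f , f∈F , f∉F′) eds′ with privateEdge f f∈F
    ... | e , e-private with e ∈? F′
    ...   | yes e∈F′ = f∉F′ (subst (_∈ F′) (e-private e (F′⊆F e∈F′) (inj₁ refl)) e∈F′)
    ...   | no e∉F′ = let g , g∈F′ , e~g = eds′ e e∉F′ in
                      f∉F′ (subst (_∈ F′) (e-private g (F′⊆F g∈F′) e~g) g∈F′)

∣p∪⁅x⁆∣≡1+∣p∣ : ∀ {N} {p : Subset N} {x} → x ∉ p → ∣ p ∪ ⁅ x ⁆ ∣ ≡ suc ∣ p ∣
∣p∪⁅x⁆∣≡1+∣p∣ {p = outside ∷ p} {zero}  _   = cong (suc ∘ ∣_∣) (∪-identityʳ p)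
∣p∪⁅x⁆∣≡1+∣p∣ {p = inside  ∷ p} {zero}  x∉p = ⊥-elim (x∉p here)
∣p∪⁅x⁆∣≡1+∣p∣ {p = outside ∷ p} {suc x} x∉p = ∣p∪⁅x⁆∣≡1+∣p∣ (x∉p ∘ there)
∣p∪⁅x⁆∣≡1+∣p∣ {p = inside  ∷ p} {suc x} x∉p = cong suc (∣p∪⁅x⁆∣≡1+∣p∣ (x∉p ∘ there))

∈-tabulate⁻ : ∀ {N} {f : Fin N → Bool} {i} → i ∈ tabulate f → T (f i)
∈-tabulate⁻ {f = f} {i} i∈ = Equivalence.from T-≡ (trans (sym (lookup∘tabulate f i)) ([]=⇒lookup i∈))

∈-tabulate⁺ : ∀ {N} {f : Fin N → Bool} {i} → T (f i) → i ∈ tabulate f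
∈-tabulate⁺ {f = f} {i} fi = lookup⇒[]= i _ (trans (lookup∘tabulate f i) (Equivalence.to T-≡ fi))

-- In a blow-up, (a , true) is the class of the first copy of vertex a, (a , false) that of its other copies.
Class : ℕ → Set
Class k = Fin k × Bool

first other : ∀ {k} → Fin k → Class k
first a = a , true
other a = a , false

copiesNeeded : Bool → ℕ
copiesNeeded true  = 1
copiesNeeded false = 2

isZero : ∀ {m} → Fin m → Bool
isZero zero    = true
isZero (suc _) = false

isFirst : (ms : Vec ℕ k) → Fin (sum ms) → Bool
isFirst (m ∷ ms) x with splitAt m x
... | inj₁ i = isZero i
... | inj₂ y = isFirst ms y

class : (ms : Vec ℕ k) → Fin (sum ms) → Class k
class ms x = label ms x , isFirst ms x

class-↑ˡ : ∀ m (ms : Vec ℕ k) (i : Fin m) → class (m ∷ ms) (i ↑ˡ sum ms) ≡ (zero , isZero i)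
class-↑ˡ m ms i rewrite splitAt-↑ˡ m i (sum ms) = refl

class-↑ʳ : ∀ m (ms : Vec ℕ k) x → class (m ∷ ms) (m ↑ʳ x) ≡ (suc (label ms x) , isFirst ms x)
class-↑ʳ m ms x rewrite splitAt-↑ʳ m (sum ms) x = refl

copiesNeeded-≤ : ∀ (ms : Vec ℕ k) x → copiesNeeded (isFirst ms x) ≤ lookupᵥ ms (label ms x)
copiesNeeded-≤ (m ∷ ms) x with splitAt m x
... | inj₁ zero          = s≤s z≤n
... | inj₁ (suc zero)    = s≤s (s≤s z≤n)
... | inj₁ (suc (suc _)) = s≤s (s≤s z≤n)
... | inj₂ y             = copiesNeeded-≤ ms y

class-inhabited : ∀ (ms : Vec ℕ k) a b → copiesNeeded b ≤ lookupᵥ ms a → ∃[ x ] class ms x ≡ (a , b)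
class-inhabited (m ∷ ms) zero true  (s≤s _)       = zero ↑ˡ sum ms , class-↑ˡ m ms zero
class-inhabited (m ∷ ms) zero false (s≤s (s≤s _)) = suc zero ↑ˡ sum ms , class-↑ˡ m ms (suc zero)
class-inhabited (m ∷ ms) (suc a) b h with class-inhabited ms a b h
... | x , refl = m ↑ʳ x , class-↑ʳ m ms x

first-copy-unique : ∀ (ms : Vec ℕ k) {x y} → class ms x ≡ class ms y → isFirst ms y ≡ true → x ≡ y
first-copy-unique (m ∷ ms) {x} {y} eq y-first
  with splitAt m x in x-split | splitAt m y in y-split
... | inj₁ zero | inj₁ zero = trans (sym (splitAt⁻¹-↑ˡ x-split)) (splitAt⁻¹-↑ˡ y-split)
... | inj₂ x′ | inj₂ y′ =
  let x′≡y′ = first-copy-unique ms (cong₂ _,_ (Fin.suc-injective (cong proj₁ eq)) (cong proj₂ eq)) y-first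
  in trans (sym (splitAt⁻¹-↑ʳ x-split)) (trans (cong (m ↑ʳ_) x′≡y′) (splitAt⁻¹-↑ʳ y-split))
... | inj₁ zero | inj₂ _ with () ← cong proj₁ eq
... | inj₂ _ | inj₁ zero with () ← cong proj₁ eq
... | inj₁ (suc _) | inj₁ zero with () ← cong proj₂ eq

_≟ᶜ_ : DecidableEquality (Class k)
_≟ᶜ_ = ≡-dec Fin._≟_ Bool._≟_

∀-class? : {P : Class k → Set} → Decidable P → Dec (∀ κ → P κ)
∀-class? P? = map′ (λ h (a , b) → h a b) (λ h a b → h (a , b)) (all? λ a → ∀-bool? (P? ∘ (a ,_)))
  where
  ∀-bool? : {Q : Bool → Set} → Decidable Q → Dec (∀ b → Q b)
  ∀-bool? Q? = map′ (λ (q₁ , q₀) → λ { true → q₁ ; false → q₀ }) (λ h → h true , h false)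
                    (Q? true ×-dec Q? false)

∃-class? : {P : Class k → Set} → Decidable P → Dec (∃ P)
∃-class? P? = map′ (λ (a , b , p) → (a , b) , p) (λ ((a , b) , p) → a , b , p)
                   (any? λ a → ∃-bool? (P? ∘ (a ,_)))
  where
  ∃-bool? : {Q : Bool → Set} → Decidable Q → Dec (∃ Q)
  ∃-bool? Q? = map′ [ (true ,_) , (false ,_) ]′ (λ { (true , q) → inj₁ q ; (false , q) → inj₂ q })
                    (Q? true ⊎-dec Q? false)

ClassPair : ℕ → Set
ClassPair k = Class k × Class k

_≟ᵖ_ : DecidableEquality (ClassPair k)
_≟ᵖ_ = ≡-dec _≟ᶜ_ _≟ᶜ_

matches : ClassPair k → Class k → Class k → Bool
matches p κ μ = ⌊ (κ , μ) ≟ᵖ p ⌋ ∨ ⌊ (μ , κ) ≟ᵖ p ⌋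

matches⇒≡ : ∀ {p} {κ μ : Class k} → T (matches p κ μ) → (κ , μ) ≡ p ⊎ (μ , κ) ≡ p
matches⇒≡ {p = p} {κ} {μ} m with Equivalence.to T-∨ m
... | inj₁ m₁ = inj₁ (toWitness {a? = (κ , μ) ≟ᵖ p} m₁)
... | inj₂ m₂ = inj₂ (toWitness {a? = (μ , κ) ≟ᵖ p} m₂)

related : List (ClassPair k) → Class k → Class k → Bool
related []       κ μ = false
related (p ∷ ps) κ μ = matches p κ μ ∨ related ps κ μ

related-sym : ∀ (ps : List (ClassPair k)) κ μ → related ps κ μ ≡ related ps μ κ
related-sym []       κ μ = refl
related-sym (p ∷ ps) κ μ = cong₂ _∨_ (∨-comm ⌊ (κ , μ) ≟ᵖ p ⌋ _) (related-sym ps κ μ)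

related-here : ∀ (ps : List (ClassPair k)) κ μ → T (related ((κ , μ) ∷ ps) κ μ)
related-here ps κ μ =
  Equivalence.from T-∨ (inj₁ (Equivalence.from T-∨ (inj₁ (fromWitness {a? = (κ , μ) ≟ᵖ (κ , μ)} refl))))

related-there : ∀ p (ps : List (ClassPair k)) {κ μ} → T (related ps κ μ) → T (related (p ∷ ps) κ μ)
related-there p ps {κ} {μ} = Equivalence.from (T-∨ {matches p κ μ}) ∘ inj₂

related-∷⁻ : ∀ p (ps : List (ClassPair k)) {κ μ} → T (related (p ∷ ps) κ μ) →
             T (matches p κ μ) ⊎ T (related ps κ μ)
related-∷⁻ p ps {κ} {μ} = Equivalence.to (T-∨ {matches p κ μ})

-- Class-level conditions, on the base graph H, under which the edges between related classes
-- form a minimal edge dominating set of H(m₁,…,m_k) for every m with lb ≤ m and min(m, 2) ≤ ub.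
module Conditions (H : Graph) (lb ub : Vec ℕ (n H)) where

  Certain Possible Singleton : Class (n H) → Set
  Certain  (a , b) = copiesNeeded b ≤ lookupᵥ lb a
  Possible (a , b) = copiesNeeded b ≤ lookupᵥ ub a
  Singleton (a , b) = b ≡ true × Certain (a , b)

  Adjacent : Class (n H) → Class (n H) → Set
  Adjacent κ μ = T (adj H (proj₁ κ) (proj₁ μ))

  module _ (ps : List (ClassPair (n H))) where

    _~_ : Class (n H) → Class (n H) → Set
    κ ~ μ = T (related ps κ μ)

    Covered : Class (n H) → Set
    Covered κ = ∃[ δ ] (κ ~ δ × Certain δ)

    OnlyPartner : Class (n H) → Class (n H) → Set
    OnlyPartner κ μ = Singleton μ × (∀ δ → κ ~ δ → δ ≡ μ)

    PrivateNeighbour : Class (n H) → Class (n H) → Set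
    PrivateNeighbour κ μ = OnlyPartner κ μ × ∃[ γ ] (Adjacent κ γ × Certain γ × (∀ δ → ¬ γ ~ δ))

    record CertifiesMinimalEDS : Set where
      field
        related⇒adjacent : ∀ κ μ → κ ~ μ → Adjacent κ μ
        dominating       : ∀ κ μ → Possible κ → Possible μ → Adjacent κ μ → κ ~ μ ⊎ Covered κ ⊎ Covered μ
        privateEdges     : ∀ κ μ → κ ~ μ →
                           (OnlyPartner κ μ × OnlyPartner μ κ) ⊎ PrivateNeighbour κ μ ⊎ PrivateNeighbour μ κ

  Extends : List (ClassPair (n H)) → ClassPair (n H) → Set
  Extends ps (κ , μ) = Singleton κ × Singleton μ × Adjacent κ μ × ¬ _~_ ps κ μ

  TwoMinimalEDSs : List (ClassPair (n H)) → (e₁ e₂ e₃ : ClassPair (n H)) → Set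
  TwoMinimalEDSs ps e₁ e₂ e₃ = CertifiesMinimalEDS (e₁ ∷ e₂ ∷ ps) × CertifiesMinimalEDS (e₃ ∷ ps)
                             × Extends (e₂ ∷ ps) e₁ × Extends ps e₂ × Extends ps e₃

  certain? : Decidable Certain
  certain? (a , b) = copiesNeeded b ≤? lookupᵥ lb a

  possible? : Decidable Possible
  possible? (a , b) = copiesNeeded b ≤? lookupᵥ ub a

  singleton? : Decidable Singleton
  singleton? (a , b) = (b Bool.≟ true) ×-dec certain? (a , b)

  adjacent? : ∀ κ μ → Dec (Adjacent κ μ)
  adjacent? κ μ = T? (adj H (proj₁ κ) (proj₁ μ))

  module _ (ps : List (ClassPair (n H))) where

    related? : ∀ κ μ → Dec (_~_ ps κ μ)
    related? κ μ = T? (related ps κ μ)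

    covered? : Decidable (Covered ps)
    covered? κ = ∃-class? (λ δ → related? κ δ ×-dec certain? δ)

    onlyPartner? : ∀ κ μ → Dec (OnlyPartner ps κ μ)
    onlyPartner? κ μ = singleton? μ ×-dec ∀-class? (λ δ → related? κ δ →-dec δ ≟ᶜ μ)

    privateNeighbour? : ∀ κ μ → Dec (PrivateNeighbour ps κ μ)
    privateNeighbour? κ μ = onlyPartner? κ μ
      ×-dec ∃-class? (λ γ → adjacent? κ γ ×-dec certain? γ ×-dec ∀-class? (λ δ → ¬? (related? γ δ)))

    certifiesMinimalEDS? : Dec (CertifiesMinimalEDS ps)
    certifiesMinimalEDS? =
      map′ (λ (a , d , p) → record { related⇒adjacent = a ; dominating = d ; privateEdges = p })
           (λ c → let open CertifiesMinimalEDS c in related⇒adjacent , dominating , privateEdges)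
      (∀² (λ κ μ → related? κ μ →-dec adjacent? κ μ)
      ×-dec ∀² (λ κ μ → possible? κ →-dec possible? μ →-dec adjacent? κ μ →-dec
                         (related? κ μ ⊎-dec covered? κ ⊎-dec covered? μ))
      ×-dec ∀² (λ κ μ → related? κ μ →-dec
                         ((onlyPartner? κ μ ×-dec onlyPartner? μ κ)
                          ⊎-dec privateNeighbour? κ μ ⊎-dec privateNeighbour? μ κ)))
      where
      ∀² : {P : Class (n H) → Class (n H) → Set} → (∀ κ μ → Dec (P κ μ)) → Dec (∀ κ μ → P κ μ)
      ∀² P? = ∀-class? (λ κ → ∀-class? (P? κ))

  extends? : ∀ ps e → Dec (Extends ps e)
  extends? ps (κ , μ) = singleton? κ ×-dec singleton? μ ×-dec adjacent? κ μ ×-dec ¬? (related? ps κ μ)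

  twoMinimalEDSs? : ∀ ps e₁ e₂ e₃ → Dec (TwoMinimalEDSs ps e₁ e₂ e₃)
  twoMinimalEDSs? ps e₁ e₂ e₃ = certifiesMinimalEDS? (e₁ ∷ e₂ ∷ ps) ×-dec certifiesMinimalEDS? (e₃ ∷ ps)
                             ×-dec extends? (e₂ ∷ ps) e₁ ×-dec extends? ps e₂ ×-dec extends? ps e₃

module Soundness (H : Graph) (ms lb ub : Vec ℕ (n H))
                 (lb≤ms : Pointwise _≤_ lb ms) (ms≲ub : Pointwise (λ m u → m ⊓ 2 ≤ u) ms ub) where

  open Conditions H lb ub

  private
    G : Graph
    G = blowup H ms

  certain-inhabited : ∀ {κ} → Certain κ → ∃[ x ] class ms x ≡ κ
  certain-inhabited {a , b} κ-certain = class-inhabited ms a b (≤-trans κ-certain (Pointwise.lookup lb≤ms a))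

  class-possible : ∀ x → Possible (class ms x)
  class-possible x = ≤-trans (⊓-glb (copiesNeeded-≤ ms x) (copiesNeeded≤2 (isFirst ms x)))
                             (Pointwise.lookup ms≲ub (label ms x))
    where
    copiesNeeded≤2 : ∀ b → copiesNeeded b ≤ 2
    copiesNeeded≤2 true  = s≤s z≤n
    copiesNeeded≤2 false = ≤-refl

  relatedEnds : List (ClassPair (n H)) → Vertex G × Vertex G → Bool
  relatedEnds ps (x , y) = related ps (class ms x) (class ms y)

  edgesOf : List (ClassPair (n H)) → Subset (nE G)
  edgesOf ps = tabulate (relatedEnds ps ∘ ends G)

  module _ (ps : List (ClassPair (n H))) where

    joins-∈⁻ : ∀ {e x y} → Joins G e x y → e ∈ edgesOf ps → _~_ ps (class ms x) (class ms y)
    joins-∈⁻ (inj₁ eq) e∈ = subst (T ∘ relatedEnds ps) eq (∈-tabulate⁻ e∈)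
    joins-∈⁻ (inj₂ eq) e∈ = subst T (related-sym ps _ _) (subst (T ∘ relatedEnds ps) eq (∈-tabulate⁻ e∈))

    joins-∈⁺ : ∀ {e x y} → Joins G e x y → _~_ ps (class ms x) (class ms y) → e ∈ edgesOf ps
    joins-∈⁺ (inj₁ eq) x~y = ∈-tabulate⁺ (subst (T ∘ relatedEnds ps) (sym eq) x~y)
    joins-∈⁺ (inj₂ eq) x~y =
      ∈-tabulate⁺ (subst (T ∘ relatedEnds ps) (sym eq) (subst T (related-sym ps _ _) x~y))

    only-edge : ∀ {f g x y w} → OnlyPartner ps (class ms x) (class ms y) → Joins G f x y →
                g ∈ edgesOf ps → Joins G g x w → g ≡ f
    only-edge {f} {g} {x} {y} {w} ((y-first , _) , only-y) f-xy g∈ g-xw =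
      joins-unique G (subst (Joins G g x) w≡y g-xw) f-xy
      where
      w≡y : w ≡ y
      w≡y = first-copy-unique ms (only-y (class ms w) (joins-∈⁻ g-xw g∈)) y-first

  module _ {ps : List (ClassPair (n H))} (cert : CertifiesMinimalEDS ps) where

    open CertifiesMinimalEDS cert

    covered⇒dominated : ∀ x → Covered ps (class ms x) → ∃[ g ] (g ∈ edgesOf ps × Incident G g x)
    covered⇒dominated x (δ , x~δ , δ-certain) with certain-inhabited δ-certain
    ... | z , refl = let g , g-xz = edge-joining G (related⇒adjacent _ _ x~δ) in
                     g , joins-∈⁺ ps g-xz x~δ , joins⇒incident G g-xz

    edgesOf-isEDS : IsEDS G (edgesOf ps)
    edgesOf-isEDS e e∉ =
      dominate (dominating _ _ (class-possible x) (class-possible y) (ends-adjacent G refl))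
      where
      x = proj₁ (ends G e)
      y = proj₂ (ends G e)
      sharing : ∀ {v} → Incident G e v → ∃[ g ] (g ∈ edgesOf ps × Incident G g v) →
                ∃[ g ] (g ∈ edgesOf ps × ShareEnd G e g)
      sharing e∋v (g , g∈ , g∋v) = g , g∈ , incident⇒shareEnd G e∋v g∋v
      dominate : _~_ ps (class ms x) (class ms y) ⊎ Covered ps (class ms x) ⊎ Covered ps (class ms y) →
                 ∃[ g ] (g ∈ edgesOf ps × ShareEnd G e g)
      dominate (inj₁ x~y)        = ⊥-elim (e∉ (joins-∈⁺ ps (inj₁ refl) x~y))
      dominate (inj₂ (inj₁ x-covered)) = sharing (inj₁ refl) (covered⇒dominated x x-covered)
      dominate (inj₂ (inj₂ y-covered)) = sharing (inj₂ refl) (covered⇒dominated y y-covered)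

    privateEdge-of-neighbour : ∀ {f x y} → Joins G f x y → PrivateNeighbour ps (class ms x) (class ms y) →
                               ∃[ e ] PrivateEdge G (edgesOf ps) f e
    privateEdge-of-neighbour f-xy (only , γ , x-γ , γ-certain , γ-isolated)
      with certain-inhabited γ-certain
    ... | z , refl = let e , e-xz = edge-joining G x-γ in
      e , privateEdge-byEnds G e-xz (only-edge ps only f-xy)
                                    (λ g∈ g-zw → ⊥-elim (γ-isolated _ (joins-∈⁻ ps g-zw g∈)))

    has-privateEdge : ∀ f → f ∈ edgesOf ps → ∃[ e ] PrivateEdge G (edgesOf ps) f e
    has-privateEdge f f∈ = choose (privateEdges _ _ (joins-∈⁻ ps f-xy f∈))
      where
      x = proj₁ (ends G f)
      y = proj₂ (ends G f)
      f-xy : Joins G f x y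
      f-xy = inj₁ refl
      choose : (OnlyPartner ps (class ms x) (class ms y) × OnlyPartner ps (class ms y) (class ms x))
               ⊎ PrivateNeighbour ps (class ms x) (class ms y)
               ⊎ PrivateNeighbour ps (class ms y) (class ms x) →
               ∃[ e ] PrivateEdge G (edgesOf ps) f e
      choose (inj₁ (only-xy , only-yx)) =
        f , privateEdge-byEnds G f-xy (only-edge ps only-xy f-xy) (only-edge ps only-yx (joins-sym G f-xy))
      choose (inj₂ (inj₁ x-private)) = privateEdge-of-neighbour f-xy x-private
      choose (inj₂ (inj₂ y-private)) = privateEdge-of-neighbour (joins-sym G f-xy) y-private

    edgesOf-isMinimalEDS : IsMinimalEDS G (edgesOf ps)
    edgesOf-isMinimalEDS = isEDS∧private⇒isMinimalEDS G edgesOf-isEDS has-privateEdge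

  first-copies-unique : ∀ {v w x y} → (class ms v , class ms w) ≡ (class ms x , class ms y) →
                        isFirst ms x ≡ true → isFirst ms y ≡ true → v ≡ x × w ≡ y
  first-copies-unique eq x-first y-first =
    first-copy-unique ms (cong proj₁ eq) x-first , first-copy-unique ms (cong proj₂ eq) y-first

  matches⇒joins : ∀ {x y g} → isFirst ms x ≡ true → isFirst ms y ≡ true →
                  T (matches (class ms x , class ms y)
                             (class ms (proj₁ (ends G g))) (class ms (proj₂ (ends G g)))) →
                  Joins G g x y
  matches⇒joins x-first y-first m with matches⇒≡ m
  ... | inj₁ eq = let p , q = first-copies-unique eq x-first y-first in inj₁ (cong₂ _,_ p q)
  ... | inj₂ eq = let p , q = first-copies-unique eq x-first y-first in inj₂ (cong₂ _,_ q p)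

  edgesOf-∷ : ∀ ps {x y e} → isFirst ms x ≡ true → isFirst ms y ≡ true → Joins G e x y →
              edgesOf ((class ms x , class ms y) ∷ ps) ≡ edgesOf ps ∪ ⁅ e ⁆
  edgesOf-∷ ps {x} {y} {e} x-first y-first e-xy = ⊆-antisym ⊆∪ ∪⊆
    where
    ⊆∪ : edgesOf ((class ms x , class ms y) ∷ ps) ⊆ edgesOf ps ∪ ⁅ e ⁆
    ⊆∪ g∈ = x∈p∪q⁺ ([ (λ m → inj₂ (subst (_∈ ⁅ e ⁆) (joins-unique G e-xy (matches⇒joins x-first y-first m))
                                             (x∈⁅x⁆ e)))
                     , (λ g~ → inj₁ (∈-tabulate⁺ g~)) ]′ (related-∷⁻ _ ps (∈-tabulate⁻ g∈)))
    ∪⊆ : edgesOf ps ∪ ⁅ e ⁆ ⊆ edgesOf ((class ms x , class ms y) ∷ ps)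
    ∪⊆ g∈ with x∈p∪q⁻ (edgesOf ps) ⁅ e ⁆ g∈
    ... | inj₁ g∈ps = ∈-tabulate⁺ (related-there _ ps (∈-tabulate⁻ g∈ps))
    ... | inj₂ g∈⁅e⁆ rewrite x∈⁅y⁆⇒x≡y e g∈⁅e⁆ =
      joins-∈⁺ ((class ms x , class ms y) ∷ ps) e-xy (related-here ps _ _)

  ∣edgesOf-∷∣ : ∀ ps {κ μ} → Extends ps (κ , μ) → ∣ edgesOf ((κ , μ) ∷ ps) ∣ ≡ suc ∣ edgesOf ps ∣
  ∣edgesOf-∷∣ ps ((κ-first , κ-certain) , (μ-first , μ-certain) , κ-μ , ¬κ~μ)
    with certain-inhabited κ-certain | certain-inhabited μ-certain
  ... | x , refl | y , refl with edge-joining G κ-μ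
  ...   | e , e-xy = begin
    ∣ edgesOf ((class ms x , class ms y) ∷ ps) ∣ ≡⟨ cong ∣_∣ (edgesOf-∷ ps κ-first μ-first e-xy) ⟩
    ∣ edgesOf ps ∪ ⁅ e ⁆ ∣                        ≡⟨ ∣p∪⁅x⁆∣≡1+∣p∣ (¬κ~μ ∘ joins-∈⁻ ps e-xy) ⟩
    suc ∣ edgesOf ps ∣                           ∎
    where open ≡-Reasoning

  twoMinimalEDSs⇒¬wellEdgeDominated : ∀ ps e₁ e₂ e₃ → TwoMinimalEDSs ps e₁ e₂ e₃ → ¬ WellEdgeDominated G
  twoMinimalEDSs⇒¬wellEdgeDominated ps e₁ e₂ e₃ (min₁₂ , min₃ , ext₁ , ext₂ , ext₃) wed = 1+n≢n (sym (begin
    suc ∣ edgesOf ps ∣              ≡⟨ ∣edgesOf-∷∣ ps ext₃ ⟨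
    ∣ edgesOf (e₃ ∷ ps) ∣           ≡⟨ wed _ _ (edgesOf-isMinimalEDS min₃) (edgesOf-isMinimalEDS min₁₂) ⟩
    ∣ edgesOf (e₁ ∷ e₂ ∷ ps) ∣      ≡⟨ ∣edgesOf-∷∣ (e₂ ∷ ps) ext₁ ⟩
    suc ∣ edgesOf (e₂ ∷ ps) ∣       ≡⟨ cong suc (∣edgesOf-∷∣ ps ext₂) ⟩
    suc (suc ∣ edgesOf ps ∣)        ∎))
    where open ≡-Reasoning

  ¬wellEdgeDominated : ∀ ps e₁ e₂ e₃ → True (twoMinimalEDSs? ps e₁ e₂ e₃) → ¬ WellEdgeDominated G
  ¬wellEdgeDominated ps e₁ e₂ e₃ = twoMinimalEDSs⇒¬wellEdgeDominated ps e₁ e₂ e₃ ∘ toWitness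

open Soundness G* using (¬wellEdgeDominated)

private
  1≤1 : 1 ≤ 1
  1≤1 = ≤-refl

  2≤2+n : ∀ n → 2 ≤ 2 + n
  2≤2+n _ = s≤s (s≤s z≤n)

  1≤n+1 : ∀ n → 1 ≤ n + 1
  1≤n+1 n = m≤n+m 1 n

  1≤n⇒2≤n+1 : ∀ {n} → 1 ≤ n → 2 ≤ n + 1
  1≤n⇒2≤n+1 = +-monoˡ-≤ 1

  m+1≤n⇒1≤n : ∀ {m n} → m + 1 ≤ n → 1 ≤ n
  m+1≤n⇒1≤n {m} m+1≤n = ≤-trans (1≤n+1 m) m+1≤n

  m+1≤n⇒1≤n∸m : ∀ {m n} → m + 1 ≤ n → 1 ≤ n ∸ m
  m+1≤n⇒1≤n∸m {m} {n} m+1≤n = m+n≤o⇒m≤o∸n 1 (subst (_≤ n) (+-comm m 1) m+1≤n)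

  m⊓2≤2 : ∀ m → m ⊓ 2 ≤ 2
  m⊓2≤2 m = m⊓n≤n m 2

-- Arguments of ¬wellEdgeDominated: m, lb, ub, the two bound proofs, the pairs common to both edge
-- sets, the two pairs of the larger set and the pair of the smaller one.
F₁₁-¬wellEdgeDominated : ∀ k →
  ¬ WellEdgeDominated (blowup G* (1 ∷ 1 ∷ 1 ∷ 1 ∷ 1 ∷ 2 + k ∷ 2 + k ∷ 0 ∷ 0 ∷ 0 ∷ 0 ∷ []))
F₁₁-¬wellEdgeDominated k =
  ¬wellEdgeDominated (1 ∷ 1 ∷ 1 ∷ 1 ∷ 1 ∷ 2 + k ∷ 2 + k ∷ 0 ∷ 0 ∷ 0 ∷ 0 ∷ [])
                     (1 ∷ 1 ∷ 1 ∷ 1 ∷ 1 ∷ 2 ∷ 2 ∷ 0 ∷ 0 ∷ 0 ∷ 0 ∷ [])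
                     (1 ∷ 1 ∷ 1 ∷ 1 ∷ 1 ∷ 2 ∷ 2 ∷ 0 ∷ 0 ∷ 0 ∷ 0 ∷ [])
    (1≤1 ∷ 1≤1 ∷ 1≤1 ∷ 1≤1 ∷ 1≤1 ∷ 2≤2+n k ∷ 2≤2+n k ∷ z≤n ∷ z≤n ∷ z≤n ∷ z≤n ∷ [])
    (1≤1 ∷ 1≤1 ∷ 1≤1 ∷ 1≤1 ∷ 1≤1 ∷ m⊓2≤2 _ ∷ m⊓2≤2 _ ∷ z≤n ∷ z≤n ∷ z≤n ∷ z≤n ∷ [])
    ((first u1 , first u2) ∷ (first u6 , other u7) ∷ (first u6 , first u7) ∷ [])
    (first u3 , first u4) (first u5 , first u6) (first u4 , first u5) _

F₁₂-¬wellEdgeDominated : ∀ k → 1 ≤ k →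
  ¬ WellEdgeDominated (blowup G* (1 ∷ 1 ∷ 1 ∷ 0 ∷ 1 ∷ suc k ∷ suc k ∷ 1 ∷ 0 ∷ 0 ∷ 0 ∷ []))
F₁₂-¬wellEdgeDominated k 1≤k =
  ¬wellEdgeDominated (1 ∷ 1 ∷ 1 ∷ 0 ∷ 1 ∷ suc k ∷ suc k ∷ 1 ∷ 0 ∷ 0 ∷ 0 ∷ [])
                     (1 ∷ 1 ∷ 1 ∷ 0 ∷ 1 ∷ 2 ∷ 2 ∷ 1 ∷ 0 ∷ 0 ∷ 0 ∷ [])
                     (1 ∷ 1 ∷ 1 ∷ 0 ∷ 1 ∷ 2 ∷ 2 ∷ 1 ∷ 0 ∷ 0 ∷ 0 ∷ [])
    (1≤1 ∷ 1≤1 ∷ 1≤1 ∷ z≤n ∷ 1≤1 ∷ s≤s 1≤k ∷ s≤s 1≤k ∷ 1≤1 ∷ z≤n ∷ z≤n ∷ z≤n ∷ [])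
    (1≤1 ∷ 1≤1 ∷ 1≤1 ∷ z≤n ∷ 1≤1 ∷ m⊓2≤2 _ ∷ m⊓2≤2 _ ∷ 1≤1 ∷ z≤n ∷ z≤n ∷ z≤n ∷ [])
    ((first u3 , first u8) ∷ (first u6 , other u7) ∷ (first u6 , first u7) ∷ [])
    (first u1 , first u2) (first u5 , first u6) (first u1 , first u5) _

F₂₁-¬wellEdgeDominated : ∀ k r s → 1 ≤ r → r + 1 ≤ k → 1 ≤ s →
  ¬ WellEdgeDominated (blowup G* (1 ∷ 1 ∷ 1 ∷ (k ∸ r ∸ s) + 1 ∷ 1 ∷ r ∷ k ∷ s ∷ 0 ∷ 0 ∷ 0 ∷ []))
F₂₁-¬wellEdgeDominated k r s 1≤r r+1≤k 1≤s =
  ¬wellEdgeDominated (1 ∷ 1 ∷ 1 ∷ (k ∸ r ∸ s) + 1 ∷ 1 ∷ r ∷ k ∷ s ∷ 0 ∷ 0 ∷ 0 ∷ [])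
                     (1 ∷ 1 ∷ 1 ∷ 1 ∷ 1 ∷ 1 ∷ 2 ∷ 1 ∷ 0 ∷ 0 ∷ 0 ∷ [])
                     (1 ∷ 1 ∷ 1 ∷ 2 ∷ 1 ∷ 2 ∷ 2 ∷ 2 ∷ 0 ∷ 0 ∷ 0 ∷ [])
    (1≤1 ∷ 1≤1 ∷ 1≤1 ∷ 1≤n+1 _ ∷ 1≤1 ∷ 1≤r ∷ ≤-trans (1≤n⇒2≤n+1 1≤r) r+1≤k ∷ 1≤s ∷ z≤n ∷ z≤n ∷ z≤n ∷ [])
    (1≤1 ∷ 1≤1 ∷ 1≤1 ∷ m⊓2≤2 _ ∷ 1≤1 ∷ m⊓2≤2 _ ∷ m⊓2≤2 _ ∷ m⊓2≤2 _ ∷ z≤n ∷ z≤n ∷ z≤n ∷ [])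
    ((other u4 , first u7) ∷ (first u4 , first u7) ∷ (other u6 , first u7) ∷ (first u6 , first u7)
      ∷ (first u7 , other u8) ∷ (first u7 , first u8) ∷ [])
    (first u1 , first u5) (first u2 , first u3) (first u1 , first u2) _

F₂₂-¬wellEdgeDominated : ∀ k r s → 1 ≤ r → r + 1 ≤ k → 1 ≤ s →
  ¬ WellEdgeDominated (blowup G* (1 ∷ 1 ∷ 1 ∷ k ∸ r ∸ s ∷ 1 ∷ r + 1 ∷ k + 1 ∷ s + 1 ∷ 0 ∷ 0 ∷ 0 ∷ []))
F₂₂-¬wellEdgeDominated k r s 1≤r r+1≤k 1≤s =
  ¬wellEdgeDominated (1 ∷ 1 ∷ 1 ∷ k ∸ r ∸ s ∷ 1 ∷ r + 1 ∷ k + 1 ∷ s + 1 ∷ 0 ∷ 0 ∷ 0 ∷ [])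
                     (1 ∷ 1 ∷ 1 ∷ 0 ∷ 1 ∷ 2 ∷ 2 ∷ 2 ∷ 0 ∷ 0 ∷ 0 ∷ [])
                     (1 ∷ 1 ∷ 1 ∷ 2 ∷ 1 ∷ 2 ∷ 2 ∷ 2 ∷ 0 ∷ 0 ∷ 0 ∷ [])
    (1≤1 ∷ 1≤1 ∷ 1≤1 ∷ z≤n ∷ 1≤1 ∷ 1≤n⇒2≤n+1 1≤r ∷ 1≤n⇒2≤n+1 (m+1≤n⇒1≤n r+1≤k) ∷ 1≤n⇒2≤n+1 1≤s
      ∷ z≤n ∷ z≤n ∷ z≤n ∷ [])
    (1≤1 ∷ 1≤1 ∷ 1≤1 ∷ m⊓2≤2 _ ∷ 1≤1 ∷ m⊓2≤2 _ ∷ m⊓2≤2 _ ∷ m⊓2≤2 _ ∷ z≤n ∷ z≤n ∷ z≤n ∷ [])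
    ((first u3 , first u8) ∷ (first u6 , other u7) ∷ (first u6 , first u7) ∷ [])
    (first u1 , first u2) (first u5 , first u6) (first u1 , first u5) _

F₃-¬wellEdgeDominated : ∀ k r s → 1 ≤ r → r + 1 ≤ k → 1 ≤ s → s + 1 ≤ k →
  ¬ WellEdgeDominated (blowup G* (1 ∷ 1 ∷ r + 1 ∷ s + 1 ∷ 1 ∷ 0 ∷ k ∸ s ∷ k ∸ r ∷ 0 ∷ 0 ∷ 0 ∷ []))
F₃-¬wellEdgeDominated k r s 1≤r r+1≤k 1≤s s+1≤k =
  ¬wellEdgeDominated (1 ∷ 1 ∷ r + 1 ∷ s + 1 ∷ 1 ∷ 0 ∷ k ∸ s ∷ k ∸ r ∷ 0 ∷ 0 ∷ 0 ∷ [])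
                     (1 ∷ 1 ∷ 2 ∷ 2 ∷ 1 ∷ 0 ∷ 1 ∷ 1 ∷ 0 ∷ 0 ∷ 0 ∷ [])
                     (1 ∷ 1 ∷ 2 ∷ 2 ∷ 1 ∷ 0 ∷ 2 ∷ 2 ∷ 0 ∷ 0 ∷ 0 ∷ [])
    (1≤1 ∷ 1≤1 ∷ 1≤n⇒2≤n+1 1≤r ∷ 1≤n⇒2≤n+1 1≤s ∷ 1≤1 ∷ z≤n ∷ m+1≤n⇒1≤n∸m s+1≤k ∷ m+1≤n⇒1≤n∸m r+1≤k
      ∷ z≤n ∷ z≤n ∷ z≤n ∷ [])
    (1≤1 ∷ 1≤1 ∷ m⊓2≤2 _ ∷ m⊓2≤2 _ ∷ 1≤1 ∷ z≤n ∷ m⊓2≤2 _ ∷ m⊓2≤2 _ ∷ z≤n ∷ z≤n ∷ z≤n ∷ [])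
    ((first u3 , other u4) ∷ (first u3 , first u4) ∷ (first u3 , other u8) ∷ (first u3 , first u8) ∷ [])
    (first u1 , first u5) (first u2 , first u3) (first u1 , first u2) _

F₄-¬wellEdgeDominated : ∀ k r s → 1 ≤ r → r + 1 ≤ k → 1 ≤ s →
  ¬ WellEdgeDominated (blowup G* (r + 1 ∷ k + 1 ∷ s + 1 ∷ 1 ∷ 1 ∷ 0 ∷ 0 ∷ 0 ∷ 0 ∷ 0 ∷ k ∸ r ∸ s ∷ []))
F₄-¬wellEdgeDominated k r s 1≤r r+1≤k 1≤s =
  ¬wellEdgeDominated (r + 1 ∷ k + 1 ∷ s + 1 ∷ 1 ∷ 1 ∷ 0 ∷ 0 ∷ 0 ∷ 0 ∷ 0 ∷ k ∸ r ∸ s ∷ [])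
                     (2 ∷ 2 ∷ 2 ∷ 1 ∷ 1 ∷ 0 ∷ 0 ∷ 0 ∷ 0 ∷ 0 ∷ 0 ∷ [])
                     (2 ∷ 2 ∷ 2 ∷ 1 ∷ 1 ∷ 0 ∷ 0 ∷ 0 ∷ 0 ∷ 0 ∷ 2 ∷ [])
    (1≤n⇒2≤n+1 1≤r ∷ 1≤n⇒2≤n+1 (m+1≤n⇒1≤n r+1≤k) ∷ 1≤n⇒2≤n+1 1≤s ∷ 1≤1 ∷ 1≤1
      ∷ z≤n ∷ z≤n ∷ z≤n ∷ z≤n ∷ z≤n ∷ z≤n ∷ [])
    (m⊓2≤2 _ ∷ m⊓2≤2 _ ∷ m⊓2≤2 _ ∷ 1≤1 ∷ 1≤1 ∷ z≤n ∷ z≤n ∷ z≤n ∷ z≤n ∷ z≤n ∷ m⊓2≤2 _ ∷ [])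
    ((first u1 , other u2) ∷ (first u1 , first u2) ∷ [])
    (first u1 , first u5) (first u3 , first u4) (first u4 , first u5) _

G*₁ : Graph
G*₁ = blowup G* (1 ∷ 1 ∷ 1 ∷ 1 ∷ 1 ∷ 1 ∷ 1 ∷ 0 ∷ 0 ∷ 0 ∷ 0 ∷ [])

G*₁≅H* : G*₁ ≅ H*
G*₁≅H* = ↔⇒⤖ σ , toWitness {a? = all? λ i → all? λ j → adj H* (σ ⟨$⟩ʳ i) (σ ⟨$⟩ʳ j) Bool.≟ adj G*₁ i j} _
  where
  σ : Permutation′ 7
  σ = transpose v6 v7

proposition9 : (ms : Vec ℕ 11) → InFamily ms →
    WellEdgeDominated (blowup G* ms) → blowup G* ms ≅ H*
proposition9 _ (inj₁ (suc zero , _ , refl)) _ = G*₁≅H*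
proposition9 _ (inj₁ (suc (suc k) , _ , refl)) wed = ⊥-elim (F₁₁-¬wellEdgeDominated k wed)
proposition9 _ (inj₂ (inj₁ (k , 1≤k , refl))) wed = ⊥-elim (F₁₂-¬wellEdgeDominated k 1≤k wed)
proposition9 _ (inj₂ (inj₂ (inj₁ (k , r , s , 1≤r , r<k , 1≤s , _ , _ , refl)))) wed =
  ⊥-elim (F₂₁-¬wellEdgeDominated k r s 1≤r r<k 1≤s wed)
proposition9 _ (inj₂ (inj₂ (inj₂ (inj₁ (k , r , s , 1≤r , r<k , 1≤s , _ , _ , refl))))) wed =
  ⊥-elim (F₂₂-¬wellEdgeDominated k r s 1≤r r<k 1≤s wed)
proposition9 _ (inj₂ (inj₂ (inj₂ (inj₂ (inj₁ (k , r , s , 1≤r , r<k , 1≤s , s<k , refl)))))) wed =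
  ⊥-elim (F₃-¬wellEdgeDominated k r s 1≤r r<k 1≤s s<k wed)
proposition9 _ (inj₂ (inj₂ (inj₂ (inj₂ (inj₂ (k , r , s , 1≤r , r<k , 1≤s , _ , _ , refl)))))) wed =
  ⊥-elim (F₄-¬wellEdgeDominated k r s 1≤r r<k 1≤s wed)
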